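{- Let $k$ and $n$ be positive integers such that $e\left(\frac{1}{2}\log(2n-1)+1\right)\le k\le n$. Then $S_k(n)$ is not an integer.
   Context: For positive integers $n$ and $k\le n$, $S_k(n)$ denotes the $k$-th elementary symmetric function of $1,1/3,\dots,1/(2n-1)$, i.e. $S_k(n)=\sum_{0\le i_1<\dots<i_k\le n-1}\prod_{j=1}^k \frac{1}{1+2i_j}$. Here $\log$ is the natural logarithm and $e$ is Euler's number. -}

module Defs where

open import Data.Bool using (Bool; true; false)
open import Data.Nat as ℕ using (ℕ; zero; suc; _!)
open import Data.Nat.Properties using (_!≢0)
open import Data.Integer using (ℤ; +_)
open import Data.Rational using (ℚ; _/_; _+_; _*_; 0ℚ; 1ℚ; ½; _≤_)
open import Data.List using (List; []; _∷_; map; _++_; filter)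
open import Data.Vec using (Vec; []; _∷_; count)
open import Data.Fin using (Fin; toℕ)
open import Data.Bool.Properties using (T?)
open import Relation.Nullary using (yes; no)
open import Data.Product using (∃)
open import Relation.Binary.PropositionalEquality using (_≡_)

-- Elementary symmetric function S_k(n) of 1, 1/3, …, 1/(2n-1),
-- defined literally as a sum over all k-element subsets of {0,…,n-1}.
-- A subset of {0,…,n-1} is a Vec Bool n (entry i = "i is chosen").

allSubsets : (n : ℕ) → List (Vec Bool n)
allSubsets zero    = [] ∷ []
allSubsets (suc n) = map (true ∷_) (allSubsets n) ++ map (false ∷_) (allSubsets n)

card : {n : ℕ} → Vec Bool n → ℕ
card []          = 0
card (true ∷ s)  = suc (card s)
card (false ∷ s) = card s

recipOdd : ℕ → ℚ
recipOdd i = (+ 1) / suc (2 ℕ.* i)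

-- product of 1/(1+2i) over chosen i; the head of a Vec of length suc n
-- corresponds to the element 0, and the tail is shifted by one.
prodSel : {n : ℕ} → ℕ → Vec Bool n → ℚ
prodSel off []          = 1ℚ
prodSel off (true ∷ s)  = recipOdd off * prodSel (suc off) s
prodSel off (false ∷ s) = prodSel (suc off) s

sumℚ : List ℚ → ℚ
sumℚ []       = 0ℚ
sumℚ (x ∷ xs) = x + sumℚ xs

ofCard : {n : ℕ} → ℕ → List (Vec Bool n) → List (Vec Bool n)
ofCard k []       = []
ofCard k (s ∷ ss) with card s ℕ.≟ k
... | yes _ = s ∷ ofCard k ss
... | no  _ = ofCard k ss

S : ℕ → ℕ → ℚ
S k n = sumℚ (map (prodSel 0) (ofCard k (allSubsets n)))

IsInteger : ℚ → Set
IsInteger q = ∃ λ (z : ℤ) → q ≡ z / 1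

-- The real hypothesis  e (½ log m + 1) ≤ k  (m = 2n-1), expressed without
-- real numbers via increasing rational lower approximations:
--   e      = Σ_{j≥0} 1/j!                         (partial sums increase to e)
--   log m  = 2 Σ_{j≥0} x^{2j+1}/(2j+1),  x = (m-1)/(m+1) ∈ [0,1)
--                                             (partial sums increase to log m)
-- All terms are ≥ 0, so  eLow N * (½ * logLow m N + 1)  is nondecreasing in N
-- with supremum e (½ log m + 1).  Hence for a real bound,
--   e (½ log m + 1) ≤ k   ⇔   ∀ N, eLow N * (½ * logLow m N + 1) ≤ k.

eLow : ℕ → ℚ
eLow zero    = 1ℚ
eLow (suc N) = eLow N + (+ 1) / (suc N !)
  where instance _ = suc N !≢0

powℚ : ℚ → ℕ → ℚ
powℚ x zero    = 1ℚ
powℚ x (suc j) = x * powℚ x j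

artanhArg : ℕ → ℚ
artanhArg m = (+ (m ℕ.∸ 1)) / suc m

logLow : ℕ → ℕ → ℚ
logLow m zero    = (+ 2) / 1 * artanhArg m
logLow m (suc N) = logLow m N
  + (+ 2) / 1 * (powℚ (artanhArg m) (suc (2 ℕ.* suc N)) * recipOdd (suc N))

BoundHyp : ℕ → ℕ → Set
BoundHyp m k = ∀ (N : ℕ) → eLow N * (½ * logLow m N + 1ℚ) ≤ (+ k) / 1

{-# OPTIONS --safe #-}
-- S_k(n) > 0, and k! S_k(n) ≤ S_1(n)^k because every product of k distinct terms occurs k! times
-- in the expansion of S_1(n)^k.  The odd harmonic sum S_1(n) is at most ½ log(2n-1) + 1: for
-- x = (n-1)/n, Bernoulli's inequality (1 - 1/n)^(2j+1) ≥ 1 - (2j+1)/n gives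
-- 1/(2j+1) ≤ x^(2j+1)/(2j+1) + 1/n, and summing over j < n compares S_1(n) - 1 with the series
-- ½ log((1+x)/(1-x)) = ½ log(2n-1).  Finally (1 + 1/j)^j ≤ e, read off the binomial expansion,
-- telescopes to k^k ≤ k! e^(k-1) < k! e^k.  So the hypothesis e S_1(n) ≤ k yields
-- S_1(n)^k ≤ (k/e)^k < k!, whence 0 < S_k(n) < 1.  Throughout, e and log are replaced by their
-- truncations eLow and logLow, which the hypothesis controls at every level.
module Submission where

open import Defs
open import Data.Bool using (Bool; true; false)
open import Data.Empty using (⊥; ⊥-elim)
open import Data.Integer as ℤ using (ℤ; +_)
import Data.Integer.Properties as ℤ
open import Data.List using (List; []; _∷_; map; _++_)
import Data.List.Properties as List
open import Data.Nat as ℕ using (ℕ; zero; suc; _!; _∸_; _^_)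
open import Data.Nat.Properties using (_!≢0)
import Data.Nat.Properties as ℕ
import Data.Nat.Solver as ℕ-Solver
open import Data.Product using (_,_)
open import Function using (_∘_)
open import Data.Rational using (ℚ; _/_; _+_; _*_; 0ℚ; 1ℚ; ½; _≤_; _<_; toℚᵘ; nonNegative; positive)
open import Data.Rational.Properties
import Data.Rational.Unnormalised as ℚᵘ
import Data.Rational.Unnormalised.Properties as ℚᵘ
open import Data.Rational.Solver using (module +-*-Solver)
open import Data.Vec using (Vec; []; _∷_)
open import Relation.Binary.PropositionalEquality
  using (_≡_; refl; sym; trans; cong; cong₂; subst; subst₂; module ≡-Reasoning)
open import Relation.Nullary using (yes; no; ¬_)

toℚᵘ-/suc : ∀ a d → toℚᵘ ((+ a) / suc d) ℚᵘ.≃ ℚᵘ.mkℚᵘ (+ a) d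
toℚᵘ-/suc a d = toℚᵘ-fromℚᵘ (ℚᵘ.mkℚᵘ (+ a) d)

/suc-mono-≤ : ∀ a d b e → a ℕ.* suc e ℕ.≤ b ℕ.* suc d → (+ a) / suc d ≤ (+ b) / suc e
/suc-mono-≤ a d b e le = toℚᵘ-cancel-≤ (ℚᵘ.≤-respʳ-≃ (ℚᵘ.≃-sym (toℚᵘ-/suc b e))
  (ℚᵘ.≤-respˡ-≃ (ℚᵘ.≃-sym (toℚᵘ-/suc a d))
    (ℚᵘ.*≤* (subst₂ ℤ._≤_ (ℤ.pos-* a (suc e)) (ℤ.pos-* b (suc d)) (ℤ.+≤+ le)))))

/suc-mono-< : ∀ a d b e → a ℕ.* suc e ℕ.< b ℕ.* suc d → (+ a) / suc d < (+ b) / suc e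
/suc-mono-< a d b e lt = toℚᵘ-cancel-< (ℚᵘ.<-respʳ-≃ (ℚᵘ.≃-sym (toℚᵘ-/suc b e))
  (ℚᵘ.<-respˡ-≃ (ℚᵘ.≃-sym (toℚᵘ-/suc a d))
    (ℚᵘ.*<* (subst₂ ℤ._<_ (ℤ.pos-* a (suc e)) (ℤ.pos-* b (suc d)) (ℤ.+<+ lt)))))

/suc-cong : ∀ a d b e → a ℕ.* suc e ≡ b ℕ.* suc d → (+ a) / suc d ≡ (+ b) / suc e
/suc-cong a d b e eq = fromℚᵘ-cong {ℚᵘ.mkℚᵘ (+ a) d} {ℚᵘ.mkℚᵘ (+ b) e}
  (ℚᵘ.*≡* (trans (sym (ℤ.pos-* a (suc e))) (trans (cong +_ eq) (ℤ.pos-* b (suc d)))))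

-- Opaque, so that unification never unfolds the gcd normalisation hidden in _/_.
opaque
  fromℕ : ℕ → ℚ
  fromℕ a = (+ a) / 1

  recipSuc : ℕ → ℚ
  recipSuc d = (+ 1) / suc d

opaque
  unfolding fromℕ recipSuc

  fromℕ-def : ∀ a → fromℕ a ≡ (+ a) / 1
  fromℕ-def a = refl

  recipSuc-def : ∀ d → recipSuc d ≡ (+ 1) / suc d
  recipSuc-def d = refl

  fromℕ-0 : fromℕ 0 ≡ 0ℚ
  fromℕ-0 = refl

  fromℕ-1 : fromℕ 1 ≡ 1ℚ
  fromℕ-1 = refl

  toℚᵘ-fromℕ : ∀ a → toℚᵘ (fromℕ a) ℚᵘ.≃ ℚᵘ.mkℚᵘ (+ a) 0
  toℚᵘ-fromℕ a = toℚᵘ-/suc a 0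

  fromℕ-homo-+ : ∀ a b → fromℕ (a ℕ.+ b) ≡ fromℕ a + fromℕ b
  fromℕ-homo-+ a b = toℚᵘ-injective (ℚᵘ.≃-trans (toℚᵘ-fromℕ (a ℕ.+ b)) (ℚᵘ.≃-sym
    (ℚᵘ.≃-trans (toℚᵘ-homo-+ (fromℕ a) (fromℕ b))
      (ℚᵘ.≃-trans (ℚᵘ.+-cong (toℚᵘ-fromℕ a) (toℚᵘ-fromℕ b)) (ℚᵘ.*≡* eq)))))
    where
    eq : (+ a ℤ.* + 1 ℤ.+ + b ℤ.* + 1) ℤ.* + 1 ≡ + (a ℕ.+ b) ℤ.* + 1
    eq rewrite ℤ.*-identityʳ (+ a) | ℤ.*-identityʳ (+ b) | ℤ.*-identityʳ (+ a ℤ.+ + b)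
      = sym (ℤ.pos-+ a b)

  fromℕ-homo-* : ∀ a b → fromℕ (a ℕ.* b) ≡ fromℕ a * fromℕ b
  fromℕ-homo-* a b = toℚᵘ-injective (ℚᵘ.≃-trans (toℚᵘ-fromℕ (a ℕ.* b)) (ℚᵘ.≃-sym
    (ℚᵘ.≃-trans (toℚᵘ-homo-* (fromℕ a) (fromℕ b))
      (ℚᵘ.≃-trans (ℚᵘ.*-cong (toℚᵘ-fromℕ a) (toℚᵘ-fromℕ b)) (ℚᵘ.*≡* eq)))))
    where
    eq : (+ a ℤ.* + b) ℤ.* + 1 ≡ + (a ℕ.* b) ℤ.* + 1
    eq rewrite ℤ.*-identityʳ (+ a ℤ.* + b) | ℤ.*-identityʳ (+ (a ℕ.* b)) = sym (ℤ.pos-* a b)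

  /suc≡fromℕ*recipSuc : ∀ a d → (+ a) / suc d ≡ fromℕ a * recipSuc d
  /suc≡fromℕ*recipSuc a d = toℚᵘ-injective (ℚᵘ.≃-trans (toℚᵘ-/suc a d) (ℚᵘ.≃-sym
    (ℚᵘ.≃-trans (toℚᵘ-homo-* (fromℕ a) (recipSuc d))
      (ℚᵘ.≃-trans (ℚᵘ.*-cong (toℚᵘ-fromℕ a) (toℚᵘ-/suc 1 d)) (ℚᵘ.*≡* eq)))))
    where
    eq : (+ a ℤ.* + 1) ℤ.* + suc d ≡ + a ℤ.* + (1 ℕ.* suc d)
    eq rewrite ℤ.*-identityʳ (+ a) | ℕ.*-identityˡ (suc d) = refl

  recipSuc-inverseˡ : ∀ d → recipSuc d * fromℕ (suc d) ≡ 1ℚ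
  recipSuc-inverseˡ d = toℚᵘ-injective (ℚᵘ.≃-trans (toℚᵘ-homo-* (recipSuc d) (fromℕ (suc d)))
    (ℚᵘ.≃-trans (ℚᵘ.*-cong (toℚᵘ-/suc 1 d) (toℚᵘ-fromℕ (suc d)))
      (ℚᵘ.≃-trans (ℚᵘ.*≡* eq) (ℚᵘ.≃-sym (toℚᵘ-fromℕ 1)))))
    where
    eq : (+ 1 ℤ.* + suc d) ℤ.* + 1 ≡ + 1 ℤ.* + (suc d ℕ.* 1)
    eq = trans (ℤ.*-identityʳ _) (trans (ℤ.*-identityˡ _)
      (sym (trans (ℤ.*-identityˡ _) (cong +_ (ℕ.*-identityʳ (suc d))))))

  fromℕ-mono-≤ : ∀ {a b} → a ℕ.≤ b → fromℕ a ≤ fromℕ b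
  fromℕ-mono-≤ {a} {b} le = /suc-mono-≤ a 0 b 0 (ℕ.*-monoˡ-≤ 1 le)

  fromℕ-mono-< : ∀ {a b} → a ℕ.< b → fromℕ a < fromℕ b
  fromℕ-mono-< {a} {b} lt = /suc-mono-< a 0 b 0 (ℕ.*-monoˡ-< 1 lt)

  recipSuc-pos : ∀ d → 0ℚ < recipSuc d
  recipSuc-pos d = /suc-mono-< 0 0 1 d (ℕ.s≤s ℕ.z≤n)

*-monoˡ-≤-0≤ : ∀ {r p q} → 0ℚ ≤ r → p ≤ q → r * p ≤ r * q
*-monoˡ-≤-0≤ {r} 0≤r = *-monoˡ-≤-nonNeg r {{nonNegative 0≤r}}

*-monoʳ-≤-0≤ : ∀ {r p q} → 0ℚ ≤ r → p ≤ q → p * r ≤ q * r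
*-monoʳ-≤-0≤ {r} 0≤r = *-monoʳ-≤-nonNeg r {{nonNegative 0≤r}}

*-monoˡ-<-0< : ∀ {r p q} → 0ℚ < r → p < q → r * p < r * q
*-monoˡ-<-0< {r} 0<r = *-monoʳ-<-pos r {{positive 0<r}}

*-cancelˡ-<-0≤ : ∀ {r p q} → 0ℚ ≤ r → r * p < r * q → p < q
*-cancelˡ-<-0≤ {r} 0≤r = *-cancelˡ-<-nonNeg r {{nonNegative 0≤r}}

0≤-* : ∀ {p q} → 0ℚ ≤ p → 0ℚ ≤ q → 0ℚ ≤ p * q
0≤-* {p} {q} 0≤p 0≤q = subst (_≤ p * q) (*-zeroʳ p) (*-monoˡ-≤-0≤ 0≤p 0≤q)

0<-* : ∀ {p q} → 0ℚ < p → 0ℚ < q → 0ℚ < p * q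
0<-* {p} {q} 0<p 0<q = subst (_< p * q) (*-zeroʳ p) (*-monoˡ-<-0< 0<p 0<q)

p≤p+q : ∀ p {q} → 0ℚ ≤ q → p ≤ p + q
p≤p+q p {q} 0≤q = subst (_≤ p + q) (+-identityʳ p) (+-monoʳ-≤ p 0≤q)

0<1 : 0ℚ < 1ℚ
0<1 = positive⁻¹ 1ℚ

0≤fromℕ : ∀ a → 0ℚ ≤ fromℕ a
0≤fromℕ a = subst (_≤ fromℕ a) fromℕ-0 (fromℕ-mono-≤ ℕ.z≤n)

fromℕ-suc : ∀ k → fromℕ (suc k) ≡ 1ℚ + fromℕ k
fromℕ-suc k = trans (fromℕ-homo-+ 1 k) (cong (_+ fromℕ k) fromℕ-1)

recipSuc-inverseʳ : ∀ d → fromℕ (suc d) * recipSuc d ≡ 1ℚ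
recipSuc-inverseʳ d = trans (*-comm (fromℕ (suc d)) (recipSuc d)) (recipSuc-inverseˡ d)

recipOdd-pos : ∀ i → 0ℚ < recipOdd i
recipOdd-pos i = subst (0ℚ <_) (recipSuc-def (2 ℕ.* i)) (recipSuc-pos (2 ℕ.* i))

recipOdd-inverseˡ : ∀ i → recipOdd i * fromℕ (suc (2 ℕ.* i)) ≡ 1ℚ
recipOdd-inverseˡ i = subst (λ r → r * fromℕ (suc (2 ℕ.* i)) ≡ 1ℚ)
  (recipSuc-def (2 ℕ.* i)) (recipSuc-inverseˡ (2 ℕ.* i))

powℚ-nonNeg : ∀ {x} → 0ℚ ≤ x → ∀ r → 0ℚ ≤ powℚ x r
powℚ-nonNeg 0≤x zero    = <⇒≤ 0<1
powℚ-nonNeg 0≤x (suc r) = 0≤-* 0≤x (powℚ-nonNeg 0≤x r)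

powℚ-pos : ∀ {x} → 0ℚ < x → ∀ r → 0ℚ < powℚ x r
powℚ-pos 0<x zero    = 0<1
powℚ-pos 0<x (suc r) = 0<-* 0<x (powℚ-pos 0<x r)

powℚ-mono-≤ : ∀ {a b} → 0ℚ ≤ a → a ≤ b → ∀ r → powℚ a r ≤ powℚ b r
powℚ-mono-≤ 0≤a a≤b zero    = ≤-refl
powℚ-mono-≤ 0≤a a≤b (suc r) = ≤-trans (*-monoʳ-≤-0≤ (powℚ-nonNeg 0≤a r) a≤b)
  (*-monoˡ-≤-0≤ (≤-trans 0≤a a≤b) (powℚ-mono-≤ 0≤a a≤b r))

powℚ-distrib-* : ∀ a b r → powℚ (a * b) r ≡ powℚ a r * powℚ b r
powℚ-distrib-* a b zero    = sym (*-identityʳ 1ℚ)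
powℚ-distrib-* a b (suc r) = trans (cong ((a * b) *_) (powℚ-distrib-* a b r))
  (solve 4 (λ a b p q → (a :* b) :* (p :* q) := (a :* p) :* (b :* q)) refl a b (powℚ a r) (powℚ b r))
  where open +-*-Solver

powℚ-one : ∀ r → powℚ 1ℚ r ≡ 1ℚ
powℚ-one zero    = refl
powℚ-one (suc r) = trans (*-identityˡ (powℚ 1ℚ r)) (powℚ-one r)

fromℕ-homo-^ : ∀ a i → fromℕ (a ^ i) ≡ powℚ (fromℕ a) i
fromℕ-homo-^ a zero    = fromℕ-1
fromℕ-homo-^ a (suc i) = trans (fromℕ-homo-* a (a ^ i)) (cong (fromℕ a *_) (fromℕ-homo-^ a i))

sum : ℕ → (ℕ → ℚ) → ℚ
sum zero    f = 0ℚ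
sum (suc m) f = sum m f + f m

syntax sum n (λ i → f) = ∑[ i < n ] f

sum-unshift : ∀ (f : ℕ → ℚ) m → ∑[ i < suc m ] f i ≡ f 0 + ∑[ i < m ] f (suc i)
sum-unshift f zero    = trans (+-identityˡ (f 0)) (sym (+-identityʳ (f 0)))
sum-unshift f (suc m) = trans (cong (_+ f (suc m)) (sum-unshift f m))
  (+-assoc (f 0) (∑[ i < m ] f (suc i)) (f (suc m)))

sum-distrib-+ : ∀ (f g : ℕ → ℚ) m → ∑[ i < m ] (f i + g i) ≡ ∑[ i < m ] f i + ∑[ i < m ] g i
sum-distrib-+ f g zero    = refl
sum-distrib-+ f g (suc m) = trans (cong (_+ (f m + g m)) (sum-distrib-+ f g m))
  (solve 4 (λ a b c d → (a :+ b) :+ (c :+ d) := (a :+ c) :+ (b :+ d)) refl (sum m f) (sum m g) (f m) (g m))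
  where open +-*-Solver

sum-distribˡ-* : ∀ c (f : ℕ → ℚ) m → ∑[ i < m ] (c * f i) ≡ c * ∑[ i < m ] f i
sum-distribˡ-* c f zero    = sym (*-zeroʳ c)
sum-distribˡ-* c f (suc m) = trans (cong (_+ c * f m) (sum-distribˡ-* c f m))
  (sym (*-distribˡ-+ c (sum m f) (f m)))

sum-const : ∀ c m → ∑[ i < m ] c ≡ fromℕ m * c
sum-const c zero    = sym (trans (cong (_* c) fromℕ-0) (*-zeroˡ c))
sum-const c (suc m) = begin
  ∑[ i < m ] c + c     ≡⟨ cong (_+ c) (sum-const c m) ⟩
  fromℕ m * c + c      ≡⟨ solve 2 (λ a c → a :* c :+ c := (con 1ℚ :+ a) :* c) refl (fromℕ m) c ⟩
  (1ℚ + fromℕ m) * c   ≡⟨ cong (_* c) (sym (fromℕ-suc m)) ⟩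
  fromℕ (suc m) * c    ∎
  where
  open ≡-Reasoning
  open +-*-Solver

sum-cong : ∀ {f g : ℕ → ℚ} → (∀ i → f i ≡ g i) → ∀ m → ∑[ i < m ] f i ≡ ∑[ i < m ] g i
sum-cong f≡g zero    = refl
sum-cong f≡g (suc m) = cong₂ _+_ (sum-cong f≡g m) (f≡g m)

sum-mono-≤ : ∀ {f g : ℕ → ℚ} → (∀ i → f i ≤ g i) → ∀ m → ∑[ i < m ] f i ≤ ∑[ i < m ] g i
sum-mono-≤ f≤g zero    = ≤-refl
sum-mono-≤ f≤g (suc m) = +-mono-≤ (sum-mono-≤ f≤g m) (f≤g m)

esym : ℕ → ℕ → ℕ → ℚ
esym off zero    zero    = 1ℚ
esym off (suc k) zero    = 0ℚ
esym off zero    (suc n) = esym (suc off) zero n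
esym off (suc k) (suc n) = recipOdd off * esym (suc off) k n + esym (suc off) (suc k) n

ofCard-++ : ∀ {n} k (xs ys : List (Vec Bool n)) → ofCard k (xs ++ ys) ≡ ofCard k xs ++ ofCard k ys
ofCard-++ k []       ys = refl
ofCard-++ k (s ∷ xs) ys with card s ℕ.≟ k
... | yes _ = cong (s ∷_) (ofCard-++ k xs ys)
... | no  _ = ofCard-++ k xs ys

ofCard-map-false : ∀ {n} k (xs : List (Vec Bool n)) →
  ofCard k (map (false ∷_) xs) ≡ map (false ∷_) (ofCard k xs)
ofCard-map-false k []       = refl
ofCard-map-false k (s ∷ xs) with card s ℕ.≟ k
... | yes _ = cong ((false ∷ s) ∷_) (ofCard-map-false k xs)
... | no  _ = ofCard-map-false k xs

ofCard-zero-map-true : ∀ {n} (xs : List (Vec Bool n)) → ofCard 0 (map (true ∷_) xs) ≡ []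
ofCard-zero-map-true []       = refl
ofCard-zero-map-true (s ∷ xs) = ofCard-zero-map-true xs

ofCard-suc-map-true : ∀ {n} k (xs : List (Vec Bool n)) →
  ofCard (suc k) (map (true ∷_) xs) ≡ map (true ∷_) (ofCard k xs)
ofCard-suc-map-true k []       = refl
ofCard-suc-map-true k (s ∷ xs) with card s ℕ.≟ k | suc (card s) ℕ.≟ suc k
... | yes _ | yes _ = cong ((true ∷ s) ∷_) (ofCard-suc-map-true k xs)
... | no  _ | no  _ = ofCard-suc-map-true k xs
... | yes p | no  q = ⊥-elim (q (cong suc p))
... | no  p | yes q = ⊥-elim (p (ℕ.suc-injective q))

sumℚ-++ : ∀ xs ys → sumℚ (xs ++ ys) ≡ sumℚ xs + sumℚ ys
sumℚ-++ []       ys = sym (+-identityˡ _)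
sumℚ-++ (x ∷ xs) ys = trans (cong (_+_ x) (sumℚ-++ xs ys)) (sym (+-assoc x _ _))

sumℚ-map-* : ∀ {A : Set} a (f : A → ℚ) xs → sumℚ (map (λ s → a * f s) xs) ≡ a * sumℚ (map f xs)
sumℚ-map-* a f []       = sym (*-zeroʳ a)
sumℚ-map-* a f (x ∷ xs) = trans (cong (_+_ (a * f x)) (sumℚ-map-* a f xs)) (sym (*-distribˡ-+ a _ _))

subsetSum≡esym : ∀ off k n →
  sumℚ (map (prodSel off) (ofCard k (allSubsets n))) ≡ esym off k n
subsetSum≡esym off zero    zero    = +-identityʳ 1ℚ
subsetSum≡esym off (suc k) zero    = refl
subsetSum≡esym off zero    (suc n) = begin
  sumℚ (map (prodSel off) (ofCard 0 (map (true ∷_) L ++ map (false ∷_) L)))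
    ≡⟨ cong (sumℚ ∘ map (prodSel off)) (trans (ofCard-++ 0 (map (true ∷_) L) _)
         (cong₂ _++_ (ofCard-zero-map-true L) (ofCard-map-false 0 L))) ⟩
  sumℚ (map (prodSel off) (map (false ∷_) (ofCard 0 L)))
    ≡⟨ cong sumℚ (sym (List.map-∘ (ofCard 0 L))) ⟩
  sumℚ (map (prodSel (suc off)) (ofCard 0 L))
    ≡⟨ subsetSum≡esym (suc off) zero n ⟩
  esym (suc off) zero n ∎
  where
  open ≡-Reasoning
  L = allSubsets n
subsetSum≡esym off (suc k) (suc n) = begin
  sumℚ (map (prodSel off) (ofCard (suc k) (map (true ∷_) L ++ map (false ∷_) L)))
    ≡⟨ cong (sumℚ ∘ map (prodSel off)) (trans (ofCard-++ (suc k) (map (true ∷_) L) _)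
         (cong₂ _++_ (ofCard-suc-map-true k L) (ofCard-map-false (suc k) L))) ⟩
  sumℚ (map (prodSel off) (map (true ∷_) (ofCard k L) ++ map (false ∷_) (ofCard (suc k) L)))
    ≡⟨ cong sumℚ (List.map-++ (prodSel off) (map (true ∷_) (ofCard k L)) _) ⟩
  sumℚ (map (prodSel off) (map (true ∷_) (ofCard k L)) ++ map (prodSel off) (map (false ∷_) (ofCard (suc k) L)))
    ≡⟨ sumℚ-++ (map (prodSel off) (map (true ∷_) (ofCard k L))) _ ⟩
  sumℚ (map (prodSel off) (map (true ∷_) (ofCard k L)))
    + sumℚ (map (prodSel off) (map (false ∷_) (ofCard (suc k) L)))
    ≡⟨ cong₂ _+_ (trans (cong sumℚ (sym (List.map-∘ (ofCard k L))))
                         (sumℚ-map-* (recipOdd off) (prodSel (suc off)) (ofCard k L)))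
                  (cong sumℚ (sym (List.map-∘ (ofCard (suc k) L)))) ⟩
  recipOdd off * sumℚ (map (prodSel (suc off)) (ofCard k L))
    + sumℚ (map (prodSel (suc off)) (ofCard (suc k) L))
    ≡⟨ cong₂ (λ a b → recipOdd off * a + b) (subsetSum≡esym (suc off) k n)
                                           (subsetSum≡esym (suc off) (suc k) n) ⟩
  esym off (suc k) (suc n) ∎
  where
  open ≡-Reasoning
  L = allSubsets n

esym-zero : ∀ off n → esym off 0 n ≡ 1ℚ
esym-zero off zero    = refl
esym-zero off (suc n) = esym-zero (suc off) n

esym-nonNeg : ∀ off k n → 0ℚ ≤ esym off k n
esym-nonNeg off zero    zero    = <⇒≤ 0<1
esym-nonNeg off (suc k) zero    = ≤-refl
esym-nonNeg off zero    (suc n) = esym-nonNeg (suc off) zero n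
esym-nonNeg off (suc k) (suc n) =
  +-mono-≤ (0≤-* (<⇒≤ (recipOdd-pos off)) (esym-nonNeg (suc off) k n)) (esym-nonNeg (suc off) (suc k) n)

esym-pos : ∀ off {k n} → k ℕ.≤ n → 0ℚ < esym off k n
esym-pos off {zero} {n} _ = subst (0ℚ <_) (sym (esym-zero off n)) 0<1
esym-pos off {suc k} {suc n} (ℕ.s≤s k≤n) =
  +-mono-<-≤ (0<-* (recipOdd-pos off) (esym-pos (suc off) k≤n)) (esym-nonNeg (suc off) (suc k) n)

newton-step : ∀ a c h x₀ x₁ x₂ → 0ℚ ≤ a → 0ℚ ≤ x₀ →
  c * x₁ ≤ h * x₀ → (1ℚ + c) * x₂ ≤ h * x₁ →
  (1ℚ + c) * (a * x₁ + x₂) ≤ (a + h) * (a * x₀ + x₁)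
newton-step a c h x₀ x₁ x₂ 0≤a 0≤x₀ cx₁≤hx₀ [1+c]x₂≤hx₁ = begin
  (1ℚ + c) * (a * x₁ + x₂)
    ≡⟨ solve 4 (λ a c x₁ x₂ → (con 1ℚ :+ c) :* (a :* x₁ :+ x₂)
                 := a :* x₁ :+ a :* (c :* x₁) :+ (con 1ℚ :+ c) :* x₂) refl a c x₁ x₂ ⟩
  a * x₁ + a * (c * x₁) + (1ℚ + c) * x₂
    ≤⟨ +-mono-≤ (+-monoʳ-≤ (a * x₁) (*-monoˡ-≤-0≤ 0≤a cx₁≤hx₀)) [1+c]x₂≤hx₁ ⟩
  a * x₁ + a * (h * x₀) + h * x₁
    ≤⟨ p≤p+q (a * x₁ + a * (h * x₀) + h * x₁) (0≤-* (0≤-* 0≤a 0≤a) 0≤x₀) ⟩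
  a * x₁ + a * (h * x₀) + h * x₁ + a * a * x₀
    ≡⟨ solve 4 (λ a h x₀ x₁ → a :* x₁ :+ a :* (h :* x₀) :+ h :* x₁ :+ a :* a :* x₀
                 := (a :+ h) :* (a :* x₀ :+ x₁)) refl a h x₀ x₁ ⟩
  (a + h) * (a * x₀ + x₁) ∎
  where
  open ≤-Reasoning
  open +-*-Solver

esym-one-suc : ∀ off n → esym off 1 (suc n) ≡ recipOdd off + esym (suc off) 1 n
esym-one-suc off n =
  cong (_+ esym (suc off) 1 n) (trans (cong (recipOdd off *_) (esym-zero (suc off) n)) (*-identityʳ (recipOdd off)))

suc*esym-suc≤esym₁*esym : ∀ off k n → fromℕ (suc k) * esym off (suc k) n ≤ esym off 1 n * esym off k n
suc*esym-suc≤esym₁*esym off k zero = begin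
  fromℕ (suc k) * 0ℚ  ≡⟨ *-zeroʳ (fromℕ (suc k)) ⟩
  0ℚ                  ≡⟨ sym (*-zeroˡ (esym off k 0)) ⟩
  0ℚ * esym off k 0   ∎
  where open ≤-Reasoning
suc*esym-suc≤esym₁*esym off zero (suc n) = begin
  fromℕ 1 * e₁                           ≡⟨ trans (cong (_* e₁) fromℕ-1) (*-identityˡ e₁) ⟩
  e₁                                     ≡⟨ sym (*-identityʳ e₁) ⟩
  e₁ * 1ℚ                                ≡⟨ cong (e₁ *_) (sym (esym-zero off (suc n))) ⟩
  e₁ * esym off 0 (suc n)                ∎
  where
  open ≤-Reasoning
  e₁ = esym off 1 (suc n)
suc*esym-suc≤esym₁*esym off (suc k) (suc n) = begin
  fromℕ (suc (suc k)) * (a * x₁ + x₂)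
    ≡⟨ cong (_* (a * x₁ + x₂)) (fromℕ-suc (suc k)) ⟩
  (1ℚ + fromℕ (suc k)) * (a * x₁ + x₂)
    ≤⟨ newton-step a (fromℕ (suc k)) h x₀ x₁ x₂ (<⇒≤ (recipOdd-pos off)) (esym-nonNeg (suc off) k n)
         (suc*esym-suc≤esym₁*esym (suc off) k n)
         (subst (λ c → c * x₂ ≤ h * x₁) (fromℕ-suc (suc k))
           (suc*esym-suc≤esym₁*esym (suc off) (suc k) n)) ⟩
  (a + h) * (a * x₀ + x₁)
    ≡⟨ cong (_* (a * x₀ + x₁)) (sym (esym-one-suc off n)) ⟩
  esym off 1 (suc n) * esym off (suc k) (suc n) ∎
  where
  open ≤-Reasoning
  a  = recipOdd off
  h  = esym (suc off) 1 n
  x₀ = esym (suc off) k n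
  x₁ = esym (suc off) (suc k) n
  x₂ = esym (suc off) (suc (suc k)) n

!*esym≤esym₁^ : ∀ off k n → fromℕ (k !) * esym off k n ≤ powℚ (esym off 1 n) k
!*esym≤esym₁^ off zero n = ≤-reflexive (trans (cong₂ _*_ fromℕ-1 (esym-zero off n)) (*-identityˡ 1ℚ))
!*esym≤esym₁^ off (suc k) n = begin
  fromℕ (suc k ℕ.* k !) * eₖ₊₁
    ≡⟨ cong (_* eₖ₊₁) (fromℕ-homo-* (suc k) (k !)) ⟩
  fromℕ (suc k) * fromℕ (k !) * eₖ₊₁
    ≡⟨ solve 3 (λ a b c → a :* b :* c := b :* (a :* c)) refl (fromℕ (suc k)) (fromℕ (k !)) eₖ₊₁ ⟩
  fromℕ (k !) * (fromℕ (suc k) * eₖ₊₁)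
    ≤⟨ *-monoˡ-≤-0≤ (0≤fromℕ (k !)) (suc*esym-suc≤esym₁*esym off k n) ⟩
  fromℕ (k !) * (e₁ * eₖ)
    ≡⟨ solve 3 (λ a b c → a :* (b :* c) := b :* (a :* c)) refl (fromℕ (k !)) e₁ eₖ ⟩
  e₁ * (fromℕ (k !) * eₖ)
    ≤⟨ *-monoˡ-≤-0≤ (esym-nonNeg off 1 n) (!*esym≤esym₁^ off k n) ⟩
  e₁ * powℚ e₁ k ∎
  where
  open ≤-Reasoning
  open +-*-Solver
  e₁   = esym off 1 n
  eₖ   = esym off k n
  eₖ₊₁ = esym off (suc k) n

esym₁≡sum : ∀ off n → esym off 1 n ≡ ∑[ i < n ] recipOdd (off ℕ.+ i)
esym₁≡sum off zero    = refl
esym₁≡sum off (suc n) = begin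
  esym off 1 (suc n)
    ≡⟨ esym-one-suc off n ⟩
  recipOdd off + esym (suc off) 1 n
    ≡⟨ cong₂ _+_ (cong recipOdd (sym (ℕ.+-identityʳ off)))
                 (trans (esym₁≡sum (suc off) n) (sum-cong (λ i → cong recipOdd (sym (ℕ.+-suc off i))) n)) ⟩
  recipOdd (off ℕ.+ 0) + ∑[ i < n ] recipOdd (off ℕ.+ suc i)
    ≡⟨ sym (sum-unshift (λ i → recipOdd (off ℕ.+ i)) n) ⟩
  ∑[ i < suc n ] recipOdd (off ℕ.+ i) ∎
  where open ≡-Reasoning

bernoulli : ∀ {x u} → 0ℚ ≤ x → 0ℚ ≤ u → x + u ≡ 1ℚ → ∀ r → 1ℚ ≤ powℚ x r + fromℕ r * u
bernoulli {x} {u} 0≤x 0≤u x+u≡1 zero = ≤-reflexive (sym (begin-equality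
  1ℚ + fromℕ 0 * u  ≡⟨ cong (λ z → 1ℚ + z * u) fromℕ-0 ⟩
  1ℚ + 0ℚ * u       ≡⟨ cong (_+_ 1ℚ) (*-zeroˡ u) ⟩
  1ℚ + 0ℚ           ≡⟨ +-identityʳ 1ℚ ⟩
  1ℚ                ∎))
  where open ≤-Reasoning
bernoulli {x} {u} 0≤x 0≤u x+u≡1 (suc r) = begin
  1ℚ                                ≡⟨ sym x+u≡1 ⟩
  x + u                             ≡⟨ cong (_+ u) (sym (*-identityʳ x)) ⟩
  x * 1ℚ + u                        ≤⟨ +-monoˡ-≤ u (*-monoˡ-≤-0≤ 0≤x (bernoulli 0≤x 0≤u x+u≡1 r)) ⟩
  x * (P + R * u) + u               ≤⟨ +-monoˡ-≤ u (p≤p+q (x * (P + R * u)) 0≤uRu) ⟩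
  x * (P + R * u) + u * (R * u) + u ≡⟨ solve 4 (λ x u P R → x :* (P :+ R :* u) :+ u :* (R :* u) :+ u
                                                 := x :* P :+ R :* u :* (x :+ u) :+ u) refl x u P R ⟩
  x * P + R * u * (x + u) + u       ≡⟨ cong (λ z → x * P + R * u * z + u) x+u≡1 ⟩
  x * P + R * u * 1ℚ + u            ≡⟨ solve 4 (λ x u P R → x :* P :+ R :* u :* con 1ℚ :+ u
                                                 := x :* P :+ (con 1ℚ :+ R) :* u) refl x u P R ⟩
  x * P + (1ℚ + R) * u              ≡⟨ cong (λ z → x * P + z * u) (sym (fromℕ-suc r)) ⟩
  powℚ x (suc r) + fromℕ (suc r) * u ∎
  where
  open ≤-Reasoning
  open +-*-Solver
  P = powℚ x r
  R = fromℕ r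
  0≤uRu : 0ℚ ≤ u * (R * u)
  0≤uRu = 0≤-* 0≤u (0≤-* (0≤fromℕ r) 0≤u)

recipOdd≤ : ∀ {x u} → 0ℚ ≤ x → 0ℚ ≤ u → x + u ≡ 1ℚ →
  ∀ j → recipOdd j ≤ powℚ x (suc (2 ℕ.* j)) * recipOdd j + u
recipOdd≤ {x} {u} 0≤x 0≤u x+u≡1 j = begin
  recipOdd j                          ≡⟨ sym (*-identityˡ (recipOdd j)) ⟩
  1ℚ * recipOdd j                     ≤⟨ *-monoʳ-≤-0≤ (<⇒≤ (recipOdd-pos j))
                                           (bernoulli 0≤x 0≤u x+u≡1 (suc (2 ℕ.* j))) ⟩
  (P + R * u) * recipOdd j            ≡⟨ solve 4 (λ P R u r → (P :+ R :* u) :* r := P :* r :+ u :* (r :* R))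
                                           refl P R u (recipOdd j) ⟩
  P * recipOdd j + u * (recipOdd j * R) ≡⟨ cong (λ z → P * recipOdd j + u * z) (recipOdd-inverseˡ j) ⟩
  P * recipOdd j + u * 1ℚ             ≡⟨ cong (_+_ (P * recipOdd j)) (*-identityʳ u) ⟩
  P * recipOdd j + u                  ∎
  where
  open ≤-Reasoning
  open +-*-Solver
  P = powℚ x (suc (2 ℕ.* j))
  R = fromℕ (suc (2 ℕ.* j))

artanhTerm : ℕ → ℕ → ℚ
artanhTerm m j = powℚ (artanhArg m) (suc (2 ℕ.* j)) * recipOdd j

½*logLow≡sum : ∀ m N → ½ * logLow m N ≡ ∑[ j < suc N ] artanhTerm m j
½*logLow≡sum m zero = begin
  ½ * ((+ 2) / 1 * x)      ≡⟨ sym (*-assoc ½ ((+ 2) / 1) x) ⟩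
  1ℚ * x                   ≡⟨ solve 1 (λ x → con 1ℚ :* x := con 0ℚ :+ x :* con 1ℚ :* con 1ℚ) refl x ⟩
  0ℚ + artanhTerm m 0      ∎
  where
  open ≡-Reasoning
  open +-*-Solver
  x = artanhArg m
½*logLow≡sum m (suc N) = begin
  ½ * (logLow m N + (+ 2) / 1 * t)          ≡⟨ *-distribˡ-+ ½ (logLow m N) _ ⟩
  ½ * logLow m N + ½ * ((+ 2) / 1 * t)      ≡⟨ cong₂ _+_ (½*logLow≡sum m N)
                                                 (trans (sym (*-assoc ½ ((+ 2) / 1) t)) (*-identityˡ t)) ⟩
  ∑[ j < suc N ] artanhTerm m j + t         ∎
  where
  open ≡-Reasoning
  t = artanhTerm m (suc N)

artanhArg-2n-1 : ∀ n → artanhArg (2 ℕ.* suc n ∸ 1) ≡ fromℕ n * recipSuc n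
artanhArg-2n-1 n = begin
  artanhArg (2 ℕ.* suc n ∸ 1)          ≡⟨ cong (λ m → artanhArg (m ∸ 1)) (ℕ.*-suc 2 n) ⟩
  (+ (2 ℕ.* n)) / suc (suc (2 ℕ.* n))  ≡⟨ /suc-cong (2 ℕ.* n) (suc (2 ℕ.* n)) n n eq ⟩
  (+ n) / suc n                        ≡⟨ /suc≡fromℕ*recipSuc n n ⟩
  fromℕ n * recipSuc n                 ∎
  where
  open ≡-Reasoning
  eq : 2 ℕ.* n ℕ.* suc n ≡ n ℕ.* suc (suc (2 ℕ.* n))
  eq = solve 1 (λ a → (con 2 :* a) :* (con 1 :+ a) := a :* (con 2 :+ con 2 :* a)) refl n
    where open ℕ-Solver.+-*-Solver

artanhArg-2n-1+recipSuc : ∀ n → artanhArg (2 ℕ.* suc n ∸ 1) + recipSuc n ≡ 1ℚ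
artanhArg-2n-1+recipSuc n = begin
  artanhArg (2 ℕ.* suc n ∸ 1) + u  ≡⟨ cong (_+ u) (artanhArg-2n-1 n) ⟩
  fromℕ n * u + u                  ≡⟨ solve 2 (λ a u → a :* u :+ u := (con 1ℚ :+ a) :* u) refl (fromℕ n) u ⟩
  (1ℚ + fromℕ n) * u               ≡⟨ cong (_* u) (sym (fromℕ-suc n)) ⟩
  fromℕ (suc n) * u                ≡⟨ recipSuc-inverseʳ n ⟩
  1ℚ                               ∎
  where
  open ≡-Reasoning
  open +-*-Solver
  u = recipSuc n

esym₁≤½*logLow+1 : ∀ n → esym 0 1 (suc n) ≤ ½ * logLow (2 ℕ.* suc n ∸ 1) (suc n) + 1ℚ
esym₁≤½*logLow+1 n = begin
  esym 0 1 (suc n)                         ≡⟨ esym₁≡sum 0 (suc n) ⟩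
  ∑[ j < suc n ] recipOdd j                ≤⟨ sum-mono-≤ (recipOdd≤ 0≤x 0≤u x+u≡1) (suc n) ⟩
  ∑[ j < suc n ] (t j + u)                 ≡⟨ sum-distrib-+ t (λ _ → u) (suc n) ⟩
  ∑[ j < suc n ] t j + ∑[ j < suc n ] u    ≡⟨ cong (_+_ (∑[ j < suc n ] t j))
                                                (trans (sum-const u (suc n)) (recipSuc-inverseʳ n)) ⟩
  ∑[ j < suc n ] t j + 1ℚ                  ≤⟨ +-monoˡ-≤ 1ℚ (p≤p+q (∑[ j < suc n ] t j) 0≤t) ⟩
  ∑[ j < suc (suc n) ] t j + 1ℚ            ≡⟨ cong (_+ 1ℚ) (sym (½*logLow≡sum m (suc n))) ⟩
  ½ * logLow m (suc n) + 1ℚ                ∎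
  where
  open ≤-Reasoning
  m = 2 ℕ.* suc n ∸ 1
  u = recipSuc n
  t = artanhTerm m
  x+u≡1 : artanhArg m + u ≡ 1ℚ
  x+u≡1 = artanhArg-2n-1+recipSuc n
  0≤u : 0ℚ ≤ u
  0≤u = <⇒≤ (recipSuc-pos n)
  0≤x : 0ℚ ≤ artanhArg m
  0≤x = subst (0ℚ ≤_) (sym (artanhArg-2n-1 n)) (0≤-* (0≤fromℕ n) 0≤u)
  0≤t : 0ℚ ≤ t (suc n)
  0≤t = 0≤-* (powℚ-nonNeg 0≤x (suc (2 ℕ.* suc n))) (<⇒≤ (recipOdd-pos (suc n)))

choose : ℕ → ℕ → ℕ
choose r       zero    = 1
choose zero    (suc i) = 0
choose (suc r) (suc i) = choose r i ℕ.+ choose r (suc i)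

choose-> : ∀ r i → r ℕ.< i → choose r i ≡ 0
choose-> zero    (suc i) _          = refl
choose-> (suc r) (suc i) (ℕ.s≤s r<i) = cong₂ ℕ._+_ (choose-> r i r<i) (choose-> r (suc i) (ℕ.m<n⇒m<1+n r<i))

^+suc*^≤suc^ : ∀ r i → r ^ suc i ℕ.+ suc i ℕ.* r ^ i ℕ.≤ suc r ^ suc i
^+suc*^≤suc^ r zero = ℕ.≤-reflexive (solve 1 (λ r → r :* con 1 :+ con 1 :* con 1 := (con 1 :+ r) :* con 1) refl r)
  where open ℕ-Solver.+-*-Solver
^+suc*^≤suc^ r (suc i) = begin
  r ^ suc (suc i) ℕ.+ suc (suc i) ℕ.* r ^ suc i
    ≡⟨ solve 3 (λ r a i → r :* (r :* a) :+ (con 2 :+ i) :* (r :* a)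
                 := r :* (r :* a) :+ (con 1 :+ i) :* (r :* a) :+ r :* a) refl r a i ⟩
  r ^ suc (suc i) ℕ.+ suc i ℕ.* r ^ suc i ℕ.+ r ^ suc i
    ≤⟨ ℕ.m≤m+n _ (suc i ℕ.* a) ⟩
  r ^ suc (suc i) ℕ.+ suc i ℕ.* r ^ suc i ℕ.+ r ^ suc i ℕ.+ suc i ℕ.* a
    ≡⟨ solve 3 (λ r a i → r :* (r :* a) :+ (con 1 :+ i) :* (r :* a) :+ r :* a :+ (con 1 :+ i) :* a
                 := (con 1 :+ r) :* (r :* a :+ (con 1 :+ i) :* a)) refl r a i ⟩
  suc r ℕ.* (r ^ suc i ℕ.+ suc i ℕ.* r ^ i)
    ≤⟨ ℕ.*-monoʳ-≤ (suc r) (^+suc*^≤suc^ r i) ⟩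
  suc r ^ suc (suc i) ∎
  where
  open ℕ.≤-Reasoning
  open ℕ-Solver.+-*-Solver
  a = r ^ i

choose*!≤^ : ∀ r i → choose r i ℕ.* i ! ℕ.≤ r ^ i
choose*!≤^ r       zero    = ℕ.≤-refl
choose*!≤^ zero    (suc i) = ℕ.z≤n
choose*!≤^ (suc r) (suc i) = begin
  (choose r i ℕ.+ choose r (suc i)) ℕ.* (suc i ℕ.* i !)
    ≡⟨ solve 4 (λ a b c f → (a :+ b) :* ((con 1 :+ c) :* f)
                 := (con 1 :+ c) :* (a :* f) :+ b :* ((con 1 :+ c) :* f)) refl (choose r i) (choose r (suc i)) i (i !) ⟩
  suc i ℕ.* (choose r i ℕ.* i !) ℕ.+ choose r (suc i) ℕ.* suc i !
    ≤⟨ ℕ.+-mono-≤ (ℕ.*-monoʳ-≤ (suc i) (choose*!≤^ r i)) (choose*!≤^ r (suc i)) ⟩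
  suc i ℕ.* r ^ i ℕ.+ r ^ suc i
    ≡⟨ ℕ.+-comm (suc i ℕ.* r ^ i) (r ^ suc i) ⟩
  r ^ suc i ℕ.+ suc i ℕ.* r ^ i
    ≤⟨ ^+suc*^≤suc^ r i ⟩
  suc r ^ suc i ∎
  where
  open ℕ.≤-Reasoning
  open ℕ-Solver.+-*-Solver

binomialTerm : ℚ → ℕ → ℕ → ℚ
binomialTerm t r i = fromℕ (choose r i) * powℚ t i

binomialTerm-suc : ∀ t r i → binomialTerm t (suc r) (suc i) ≡ t * binomialTerm t r i + binomialTerm t r (suc i)
binomialTerm-suc t r i = trans (cong (_* powℚ t (suc i)) (fromℕ-homo-+ (choose r i) (choose r (suc i))))
  (solve 4 (λ a b t p → (a :+ b) :* (t :* p) := t :* (a :* p) :+ b :* (t :* p))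
     refl (fromℕ (choose r i)) (fromℕ (choose r (suc i))) t (powℚ t i))
  where open +-*-Solver

binomialTerm-> : ∀ t r → binomialTerm t r (suc r) ≡ 0ℚ
binomialTerm-> t r = begin
  fromℕ (choose r (suc r)) * powℚ t (suc r)  ≡⟨ cong (λ c → fromℕ c * powℚ t (suc r))
                                                  (choose-> r (suc r) (ℕ.n<1+n r)) ⟩
  fromℕ 0 * powℚ t (suc r)                   ≡⟨ cong (_* powℚ t (suc r)) fromℕ-0 ⟩
  0ℚ * powℚ t (suc r)                        ≡⟨ *-zeroˡ (powℚ t (suc r)) ⟩
  0ℚ                                         ∎
  where open ≡-Reasoning

binomial : ∀ t r → powℚ (1ℚ + t) r ≡ ∑[ i < suc r ] binomialTerm t r i
binomial t zero = sym (trans (+-identityˡ (fromℕ 1 * 1ℚ)) (trans (*-identityʳ (fromℕ 1)) fromℕ-1))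
binomial t (suc r) = begin
  (1ℚ + t) * powℚ (1ℚ + t) r
    ≡⟨ cong ((1ℚ + t) *_) (binomial t r) ⟩
  (1ℚ + t) * B
    ≡⟨ solve 2 (λ t B → (con 1ℚ :+ t) :* B := B :+ t :* B) refl t B ⟩
  B + t * B
    ≡⟨ cong (_+ t * B) (trans (sum-unshift b r) (cong (_+_ (b 0)) (sym top-vanishes))) ⟩
  b 0 + ∑[ i < suc r ] b (suc i) + t * B
    ≡⟨ solve 3 (λ a c d → a :+ c :+ d := a :+ (d :+ c)) refl (b 0) (∑[ i < suc r ] b (suc i)) (t * B) ⟩
  b 0 + (t * B + ∑[ i < suc r ] b (suc i))
    ≡⟨ cong (_+_ (b 0)) (trans (cong (_+ ∑[ i < suc r ] b (suc i)) (sym (sum-distribˡ-* t b (suc r))))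
                              (sym (sum-distrib-+ (λ i → t * b i) (λ i → b (suc i)) (suc r)))) ⟩
  b 0 + ∑[ i < suc r ] (t * b i + b (suc i))
    ≡⟨ cong (_+_ (b 0)) (sum-cong (λ i → sym (binomialTerm-suc t r i)) (suc r)) ⟩
  binomialTerm t (suc r) 0 + ∑[ i < suc r ] binomialTerm t (suc r) (suc i)
    ≡⟨ sym (sum-unshift (binomialTerm t (suc r)) (suc r)) ⟩
  ∑[ i < suc (suc r) ] binomialTerm t (suc r) i ∎
  where
  open ≡-Reasoning
  open +-*-Solver
  b = binomialTerm t r
  B = ∑[ i < suc r ] b i
  top-vanishes : ∑[ i < suc r ] b (suc i) ≡ ∑[ i < r ] b (suc i)
  top-vanishes = trans (cong (_+_ (∑[ i < r ] b (suc i))) (binomialTerm-> t r)) (+-identityʳ _)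

recipFactorial : ℕ → ℚ
recipFactorial i = ((+ 1) / i !) {{i !≢0}}

recipFactorial-inverseˡ : ∀ i → recipFactorial i * fromℕ (i !) ≡ 1ℚ
recipFactorial-inverseˡ i = inverse (i !) {{i !≢0}}
  where
  inverse : ∀ d .{{_ : ℕ.NonZero d}} → ((+ 1) / d) * fromℕ d ≡ 1ℚ
  inverse (suc d) = subst (λ r → r * fromℕ (suc d) ≡ 1ℚ) (recipSuc-def d) (recipSuc-inverseˡ d)

recipFactorial-pos : ∀ i → 0ℚ < recipFactorial i
recipFactorial-pos i = 0<1/ (i !) {{i !≢0}}
  where
  0<1/ : ∀ d .{{_ : ℕ.NonZero d}} → 0ℚ < (+ 1) / d
  0<1/ (suc d) = subst (0ℚ <_) (recipSuc-def d) (recipSuc-pos d)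

eLow≡sum : ∀ N → eLow N ≡ ∑[ i < suc N ] recipFactorial i
eLow≡sum zero    = sym (+-identityˡ 1ℚ)
eLow≡sum (suc N) = cong (_+ recipFactorial (suc N)) (eLow≡sum N)

choose≤^*recipFactorial : ∀ r i → fromℕ (choose r i) ≤ fromℕ (r ^ i) * recipFactorial i
choose≤^*recipFactorial r i = begin
  c                                ≡⟨ sym (*-identityʳ c) ⟩
  c * 1ℚ                           ≡⟨ cong (c *_) (sym (trans (*-comm (fromℕ (i !)) ρ)
                                                               (recipFactorial-inverseˡ i))) ⟩
  c * (fromℕ (i !) * ρ)            ≡⟨ sym (*-assoc c (fromℕ (i !)) ρ) ⟩
  c * fromℕ (i !) * ρ              ≡⟨ cong (_* ρ) (sym (fromℕ-homo-* (choose r i) (i !))) ⟩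
  fromℕ (choose r i ℕ.* i !) * ρ   ≤⟨ *-monoʳ-≤-0≤ (<⇒≤ (recipFactorial-pos i))
                                                     (fromℕ-mono-≤ (choose*!≤^ r i)) ⟩
  fromℕ (r ^ i) * ρ                ∎
  where
  open ≤-Reasoning
  c = fromℕ (choose r i)
  ρ = recipFactorial i

1+^≤sum : ∀ {t} → 0ℚ ≤ t → ∀ r →
  powℚ (1ℚ + t) r ≤ ∑[ i < suc r ] (fromℕ (r ^ i) * powℚ t i * recipFactorial i)
1+^≤sum {t} 0≤t r = begin
  powℚ (1ℚ + t) r                                       ≡⟨ binomial t r ⟩
  ∑[ i < suc r ] (fromℕ (choose r i) * powℚ t i)         ≤⟨ sum-mono-≤ bound (suc r) ⟩
  ∑[ i < suc r ] (fromℕ (r ^ i) * powℚ t i * recipFactorial i) ∎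
  where
  open ≤-Reasoning
  open +-*-Solver
  bound : ∀ i → fromℕ (choose r i) * powℚ t i ≤ fromℕ (r ^ i) * powℚ t i * recipFactorial i
  bound i = ≤-trans (*-monoʳ-≤-0≤ (powℚ-nonNeg 0≤t i) (choose≤^*recipFactorial r i))
    (≤-reflexive (solve 3 (λ a p ρ → a :* ρ :* p := a :* p :* ρ)
                    refl (fromℕ (r ^ i)) (powℚ t i) (recipFactorial i)))

1+recipSuc^≤eLow : ∀ j → powℚ (1ℚ + recipSuc j) (suc j) ≤ eLow (suc j)
1+recipSuc^≤eLow j = begin
  powℚ (1ℚ + u) (suc j)                                               ≤⟨ 1+^≤sum (<⇒≤ (recipSuc-pos j)) (suc j) ⟩
  ∑[ i < suc (suc j) ] (fromℕ (suc j ^ i) * powℚ u i * recipFactorial i) ≡⟨ sum-cong unit (suc (suc j)) ⟩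
  ∑[ i < suc (suc j) ] recipFactorial i                                ≡⟨ sym (eLow≡sum (suc j)) ⟩
  eLow (suc j)                                                         ∎
  where
  open ≤-Reasoning
  u = recipSuc j
  unit : ∀ i → fromℕ (suc j ^ i) * powℚ u i * recipFactorial i ≡ recipFactorial i
  unit i = begin-equality
    fromℕ (suc j ^ i) * powℚ u i * ρ
      ≡⟨ cong (λ a → a * powℚ u i * ρ) (fromℕ-homo-^ (suc j) i) ⟩
    powℚ (fromℕ (suc j)) i * powℚ u i * ρ
      ≡⟨ cong (_* ρ) (sym (powℚ-distrib-* (fromℕ (suc j)) u i)) ⟩
    powℚ (fromℕ (suc j) * u) i * ρ
      ≡⟨ cong (λ a → powℚ a i * ρ) (recipSuc-inverseʳ j) ⟩
    powℚ 1ℚ i * ρ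
      ≡⟨ trans (cong (_* ρ) (powℚ-one i)) (*-identityˡ ρ) ⟩
    ρ ∎
    where ρ = recipFactorial i

eLow-mono-≤ : ∀ {a b} → a ℕ.≤ b → eLow a ≤ eLow b
eLow-mono-≤ a≤b = mono′ (ℕ.≤⇒≤′ a≤b)
  where
  mono′ : ∀ {a b} → a ℕ.≤′ b → eLow a ≤ eLow b
  mono′ ℕ.≤′-refl             = ≤-refl
  mono′ (ℕ.≤′-step {b} a≤′b) = ≤-trans (mono′ a≤′b) (p≤p+q (eLow b) (<⇒≤ (recipFactorial-pos (suc b))))

1≤eLow : ∀ N → 1ℚ ≤ eLow N
1≤eLow N = eLow-mono-≤ {0} {N} ℕ.z≤n

0<eLow : ∀ N → 0ℚ < eLow N
0<eLow N = <-≤-trans 0<1 (1≤eLow N)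

1<eLow-suc : ∀ N → 1ℚ < eLow (suc N)
1<eLow-suc N = subst (_< eLow (suc N)) (+-identityʳ 1ℚ) (+-mono-≤-< (1≤eLow N) (recipFactorial-pos (suc N)))

suc^≤eLow*^ : ∀ j → fromℕ (suc (suc j) ^ suc j) ≤ eLow (suc j) * fromℕ (suc j ^ suc j)
suc^≤eLow*^ j = begin
  fromℕ (suc J ^ J)                         ≡⟨ fromℕ-homo-^ (suc J) J ⟩
  powℚ (fromℕ (suc J)) J                    ≡⟨ cong (λ a → powℚ a J) suc≡ ⟩
  powℚ ((1ℚ + u) * fromℕ J) J               ≡⟨ powℚ-distrib-* (1ℚ + u) (fromℕ J) J ⟩
  powℚ (1ℚ + u) J * powℚ (fromℕ J) J        ≤⟨ *-monoʳ-≤-0≤ (powℚ-nonNeg (0≤fromℕ J) J)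
                                                                (1+recipSuc^≤eLow j) ⟩
  eLow J * powℚ (fromℕ J) J                 ≡⟨ cong (eLow J *_) (sym (fromℕ-homo-^ J J)) ⟩
  eLow J * fromℕ (J ^ J)                    ∎
  where
  open ≤-Reasoning
  open +-*-Solver
  J = suc j
  u = recipSuc j
  suc≡ : fromℕ (suc J) ≡ (1ℚ + u) * fromℕ J
  suc≡ = begin-equality
    fromℕ (suc J)              ≡⟨ fromℕ-suc J ⟩
    1ℚ + fromℕ J               ≡⟨ cong (_+ fromℕ J) (sym (recipSuc-inverseʳ j)) ⟩
    fromℕ J * u + fromℕ J      ≡⟨ solve 2 (λ a u → a :* u :+ a := (con 1ℚ :+ u) :* a) refl (fromℕ J) u ⟩
    (1ℚ + u) * fromℕ J         ∎

^≤!*eLow^ : ∀ N j → j ℕ.≤ N → fromℕ (suc j ^ suc j) ≤ fromℕ (suc j !) * powℚ (eLow N) j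
^≤!*eLow^ N zero    _     = ≤-reflexive (sym (*-identityʳ (fromℕ 1)))
^≤!*eLow^ N (suc j) j<N = begin
  fromℕ (suc J ^ suc J)                       ≡⟨ fromℕ-homo-* (suc J) (suc J ^ J) ⟩
  fromℕ (suc J) * fromℕ (suc J ^ J)           ≤⟨ *-monoˡ-≤-0≤ (0≤fromℕ (suc J)) (suc^≤eLow*^ j) ⟩
  fromℕ (suc J) * (eLow J * fromℕ (J ^ J))    ≤⟨ *-monoˡ-≤-0≤ (0≤fromℕ (suc J))
                                                   (*-monoʳ-≤-0≤ (0≤fromℕ (J ^ J)) (eLow-mono-≤ j<N)) ⟩
  fromℕ (suc J) * (E * fromℕ (J ^ J))         ≤⟨ *-monoˡ-≤-0≤ (0≤fromℕ (suc J)) (*-monoˡ-≤-0≤ 0≤E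
                                                   (^≤!*eLow^ N j (ℕ.<⇒≤ j<N))) ⟩
  fromℕ (suc J) * (E * (fromℕ (J !) * powℚ E j))
    ≡⟨ solve 4 (λ a e b p → a :* (e :* (b :* p)) := (a :* b) :* (e :* p))
         refl (fromℕ (suc J)) E (fromℕ (J !)) (powℚ E j) ⟩
  fromℕ (suc J) * fromℕ (J !) * (E * powℚ E j)
    ≡⟨ cong (_* (E * powℚ E j)) (sym (fromℕ-homo-* (suc J) (J !))) ⟩
  fromℕ (suc J !) * powℚ E J                  ∎
  where
  open ≤-Reasoning
  open +-*-Solver
  J = suc j
  E = eLow N
  0≤E : 0ℚ ≤ E
  0≤E = <⇒≤ (0<eLow N)

^<!*eLow^ : ∀ N k → k ℕ.≤ suc N → fromℕ (suc k ^ suc k) < fromℕ (suc k !) * powℚ (eLow (suc N)) (suc k)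
^<!*eLow^ N k k≤1+N = begin-strict
  fromℕ (suc k ^ suc k)         ≤⟨ ^≤!*eLow^ (suc N) k k≤1+N ⟩
  F * powℚ E k                  ≡⟨ sym (*-identityʳ (F * powℚ E k)) ⟩
  F * powℚ E k * 1ℚ             <⟨ *-monoˡ-<-0< (0<-* 0<F (powℚ-pos 0<E k)) (1<eLow-suc N) ⟩
  F * powℚ E k * E              ≡⟨ solve 3 (λ f p e → f :* p :* e := f :* (e :* p)) refl F (powℚ E k) E ⟩
  F * powℚ E (suc k)            ∎
  where
  open ≤-Reasoning
  open +-*-Solver
  F = fromℕ (suc k !)
  E = eLow (suc N)
  0<F : 0ℚ < F
  0<F = subst (_< F) fromℕ-0 (fromℕ-mono-< (ℕ.>-nonZero⁻¹ (suc k !) {{suc k !≢0}}))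
  0<E : 0ℚ < E
  0<E = 0<eLow (suc N)

^<! : ∀ {h} N k → k ℕ.≤ suc N → 0ℚ ≤ h → eLow (suc N) * h ≤ fromℕ (suc k) →
  powℚ h (suc k) < fromℕ (suc k !)
^<! {h} N k k≤1+N 0≤h E*h≤K = *-cancelˡ-<-0≤ (powℚ-nonNeg 0≤E K) (begin-strict
  powℚ E K * powℚ h K        ≡⟨ sym (powℚ-distrib-* E h K) ⟩
  powℚ (E * h) K             ≤⟨ powℚ-mono-≤ (0≤-* 0≤E 0≤h) E*h≤K K ⟩
  powℚ (fromℕ K) K           ≡⟨ sym (fromℕ-homo-^ K K) ⟩
  fromℕ (K ^ K)              <⟨ ^<!*eLow^ N k k≤1+N ⟩
  fromℕ (K !) * powℚ E K     ≡⟨ *-comm (fromℕ (K !)) (powℚ E K) ⟩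
  powℚ E K * fromℕ (K !)     ∎)
  where
  open ≤-Reasoning
  K = suc k
  E = eLow (suc N)
  0≤E : 0ℚ ≤ E
  0≤E = <⇒≤ (0<eLow (suc N))

esym<1 : ∀ off k n → powℚ (esym off 1 n) k < fromℕ (k !) → esym off k n < 1ℚ
esym<1 off k n e₁^k<k! = *-cancelˡ-<-0≤ (0≤fromℕ (k !)) (begin-strict
  fromℕ (k !) * esym off k n   ≤⟨ !*esym≤esym₁^ off k n ⟩
  powℚ (esym off 1 n) k        <⟨ e₁^k<k! ⟩
  fromℕ (k !)                  ≡⟨ sym (*-identityʳ (fromℕ (k !))) ⟩
  fromℕ (k !) * 1ℚ             ∎)
  where open ≤-Reasoning

z/1∉⟨0,1⟩ : ∀ z → 0ℚ < z / 1 → z / 1 < 1ℚ → ⊥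
z/1∉⟨0,1⟩ z 0<z z<1 = no-ℤ-between z (numerator-> (ℚᵘ.<-respʳ-≃ toℚᵘ-z (toℚᵘ-mono-< 0<z)))
                                      (numerator-< (ℚᵘ.<-respˡ-≃ toℚᵘ-z (toℚᵘ-mono-< z<1)))
  where
  toℚᵘ-z : toℚᵘ (z / 1) ℚᵘ.≃ ℚᵘ.mkℚᵘ z 0
  toℚᵘ-z = toℚᵘ-fromℚᵘ (ℚᵘ.mkℚᵘ z 0)
  numerator-> : ℚᵘ.mkℚᵘ (+ 0) 0 ℚᵘ.< ℚᵘ.mkℚᵘ z 0 → + 0 ℤ.< z
  numerator-> (ℚᵘ.*<* lt) = subst (+ 0 ℤ.<_) (ℤ.*-identityʳ z) lt
  numerator-< : ℚᵘ.mkℚᵘ z 0 ℚᵘ.< ℚᵘ.mkℚᵘ (+ 1) 0 → z ℤ.< + 1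
  numerator-< (ℚᵘ.*<* lt) = subst (ℤ._< + 1) (ℤ.*-identityʳ z) lt
  no-ℤ-between : ∀ z → + 0 ℤ.< z → z ℤ.< + 1 → ⊥
  no-ℤ-between (+ suc a) (ℤ.+<+ _) (ℤ.+<+ (ℕ.s≤s ()))

lemma2p3 : (k n : ℕ) → 1 ℕ.≤ k → 1 ℕ.≤ n → BoundHyp (2 ℕ.* n ∸ 1) k → k ℕ.≤ n
    → ¬ IsInteger (S k n)
lemma2p3 zero    _       ()
lemma2p3 (suc k) zero    _  _ _ ()
lemma2p3 (suc k) (suc n) _ _ hyp 1+k≤1+n (z , S≡z) =
  z/1∉⟨0,1⟩ z (subst (0ℚ <_) S≡z 0<S) (subst (_< 1ℚ) S≡z S<1)
  where
  esym≡S : esym 0 (suc k) (suc n) ≡ S (suc k) (suc n)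
  esym≡S = sym (subsetSum≡esym 0 (suc k) (suc n))
  0<S : 0ℚ < S (suc k) (suc n)
  0<S = subst (0ℚ <_) esym≡S (esym-pos 0 1+k≤1+n)
  E*e₁≤k : eLow (suc n) * esym 0 1 (suc n) ≤ fromℕ (suc k)
  E*e₁≤k = ≤-trans (*-monoˡ-≤-0≤ (<⇒≤ (0<eLow (suc n))) (esym₁≤½*logLow+1 n))
                   (subst (_ ≤_) (sym (fromℕ-def (suc k))) (hyp (suc n)))
  S<1 : S (suc k) (suc n) < 1ℚ
  S<1 = subst (_< 1ℚ) esym≡S (esym<1 0 (suc k) (suc n)
          (^<! n k (ℕ.<⇒≤ 1+k≤1+n) (esym-nonNeg 0 1 (suc n)) E*e₁≤k))
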